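{- Let $X\subseteq\mathbb{L}$, $a\in X$, and let $f\colon\mathbb{L}\to\mathbb{L}$ satisfy $f(a)|f(X\setminus\{a\})$. Then $f$ behaves as $\mathrm{rer}_a$ on $X\setminus\{a\}$ if and only if $f$ preserves $Q$ on $X$.
   Context: A finite rooted binary tree is a finite rooted tree in which every non-leaf vertex has exactly two children; its leaf structure is the structure on its set of leaves with the ternary relation $C$ where $C(x;yz)$ holds iff the youngest common ancestor of $y$ and $z$ is a proper descendant of the youngest common ancestor of $x,y,z$ (so $C(x;yy)$ holds whenever $x\neq y$). $(\mathbb{L};C)$ denotes the unique (up to isomorphism) countable homogeneous structure whose finite substructures are, up to isomorphism, exactly the leaf structures of finite rooted binary trees. We write $xy|z$ for $C(z;xy)$; $a_1\dots a_m|b_1\dots b_n$ (resp. $Y|Z$ for sets) means $a_ia_j|b_k$ and $b_kb_l|a_i$ for all $i,j,k,l$ (resp. all choices from $Y,Z$). $Q$ is the quaternary relation $xy:uv\iff(xy|u\wedge xy|v)\vee(x|uv\wedge y|uv)$; $f$ preserves $Q$ on $Y$ if $a_1a_2:a_3a_4$ implies $f(a_1)f(a_2):f(a_3)f(a_4)$ for all $a_i\in Y$. For $x\neq c$, $S^c_x=\{y\in\mathbb{L}\setminus\{c\}:xy|c\}$. $e$ preserves $C$ on $B$ if $C(x;yz)$ implies $C(e(x);e(y)e(z))$ for $x,y,z\in B$. For $A\subseteq\mathbb{L}\setminus\{c\}$, $e$ behaves as $\mathrm{rer}_c$ on $A$ if (1) $e(c)|e(A\cap S^c_b)$ for every $b\in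 A$, (2) $e$ preserves $C$ on $A\cap S^c_b$ for every $b\in A$, (3) for all $b,d\in A$ either $S^c_b=S^c_d$ or $e(A\cap S^c_b)|e(A\cap S^c_d)$, and (4) for all $x,y,z\in A$ with $x|yzc$ and $y|zc$: $e(x)e(y)e(z)|e(c)$ and $e(x)e(y)|e(z)$. -}

module Defs where

open import Level using (0ℓ)
open import Data.Nat using (ℕ; suc)
open import Data.Fin using (Fin)
open import Data.Empty using (⊥)
open import Data.Unit using (⊤)
open import Data.Product using (Σ; ∃; _×_; _,_)
open import Data.Sum using (_⊎_)
open import Data.List using (List; _∷_; [])
open import Data.List.Membership.Propositional using (_∈_)
open import Relation.Nullary using (¬_)
open import Relation.Unary using (Pred; _∩_)
open import Relation.Binary.PropositionalEquality using (_≡_; _≢_)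
open import Function.Bundles using (_⇔_; _⤖_; Bijection)
open import Function.Definitions using (Injective; Surjective)

data BTree : Set where
  leaf : BTree
  node : BTree → BTree → BTree

data Leaf : BTree → Set where
  here  : Leaf leaf
  left  : ∀ {l r} → Leaf l → Leaf (node l r)
  right : ∀ {l r} → Leaf r → Leaf (node l r)

-- CT x y z  is  C(x;yz): the youngest common ancestor of y and z is a
-- proper descendant of the youngest common ancestor of x, y, z.
CT : ∀ {t} → Leaf t → Leaf t → Leaf t → Set
CT here here here = ⊥
CT (left x)  (left y)  (left z)  = CT x y z
CT (right x) (right y) (right z) = CT x y z
CT (left _)  (right _) (right _) = ⊤
CT (right _) (left _)  (left _)  = ⊤
CT (left _)  (left _)  (right _) = ⊥
CT (left _)  (right _) (left _)  = ⊥
CT (right _) (left _)  (right _) = ⊥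
CT (right _) (right _) (left _)  = ⊥

-- (𝕃; C): a countable homogeneous structure whose finite substructures
-- are, up to isomorphism, exactly the leaf structures of finite rooted
-- binary trees.  (Unique up to isomorphism; we quantify over all such.)

record LStructure : Set₁ where
  field
    Carrier : Set
    C       : Carrier → Carrier → Carrier → Set
    enum     : ℕ → Carrier
    enum-surj : Surjective _≡_ _≡_ enum
    age-⊆ : ∀ n (g : Fin (suc n) → Carrier) → Injective _≡_ _≡_ g →
            Σ BTree λ t → Σ (Fin (suc n) ⤖ Leaf t) λ h →
              ∀ i j k → C (g i) (g j) (g k) ⇔
                        CT (Bijection.to h i) (Bijection.to h j) (Bijection.to h k)
    age-⊇ : ∀ t → Σ (Leaf t → Carrier) λ e → Injective _≡_ _≡_ e ×
              (∀ x y z → CT x y z ⇔ C (e x) (e y) (e z))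
    homogeneous : ∀ n (g₁ g₂ : Fin n → Carrier) →
                  Injective _≡_ _≡_ g₁ → Injective _≡_ _≡_ g₂ →
                  (∀ i j k → C (g₁ i) (g₁ j) (g₁ k) ⇔ C (g₂ i) (g₂ j) (g₂ k)) →
                  Σ (Carrier ⤖ Carrier) λ σ →
                    (∀ x y z → C x y z ⇔
                       C (Bijection.to σ x) (Bijection.to σ y) (Bijection.to σ z)) ×
                    (∀ i → Bijection.to σ (g₁ i) ≡ g₂ i)

module Notions (𝕃 : LStructure) where
  open LStructure 𝕃 renaming (Carrier to L)

  _∣∣_∣_ : L → L → L → Set
  x ∣∣ y ∣ z = C z x y

  Sep : Pred L 0ℓ → Pred L 0ℓ → Set
  Sep Y Z = (∀ y y' z → Y y → Y y' → Z z → C z y y') ×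
            (∀ z z' y → Z z → Z z' → Y y → C y z z')

  SepL : List L → List L → Set
  SepL ys zs = Sep (λ x → x ∈ ys) (λ x → x ∈ zs)

  ⟦_⟧ : L → Pred L 0ℓ
  ⟦ a ⟧ x = x ≡ a

  Img : (L → L) → Pred L 0ℓ → Pred L 0ℓ
  Img f A y = ∃ λ x → A x × f x ≡ y

  _∖｛_｝ : Pred L 0ℓ → L → Pred L 0ℓ
  (X ∖｛ a ｝) x = X x × x ≢ a

  Q : L → L → L → L → Set
  Q x y u v = (C u x y × C v x y) ⊎ (C x u v × C y u v)

  preservesQ : (L → L) → Pred L 0ℓ → Set
  preservesQ f Y = ∀ a₁ a₂ a₃ a₄ → Y a₁ → Y a₂ → Y a₃ → Y a₄ →
                   Q a₁ a₂ a₃ a₄ → Q (f a₁) (f a₂) (f a₃) (f a₄)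

  S : L → L → Pred L 0ℓ
  S c x y = y ≢ c × C c x y

  preservesC : (L → L) → Pred L 0ℓ → Set
  preservesC e B = ∀ x y z → B x → B y → B z → C x y z → C (e x) (e y) (e z)

  behavesRer : (L → L) → L → Pred L 0ℓ → Set
  behavesRer e c A =
    (∀ b → A b → Sep ⟦ e c ⟧ (Img e (A ∩ S c b))) ×
    (∀ b → A b → preservesC e (A ∩ S c b)) ×
    (∀ b d → A b → A d →
       (∀ y → (S c b y → S c d y) × (S c d y → S c b y)) ⊎
       Sep (Img e (A ∩ S c b)) (Img e (A ∩ S c d))) ×
    (∀ x y z → A x → A y → A z →
       SepL (x ∷ []) (y ∷ z ∷ c ∷ []) → SepL (y ∷ []) (z ∷ c ∷ []) →
       SepL (e x ∷ e y ∷ e z ∷ []) (e c ∷ []) × SepL (e x ∷ e y ∷ []) (e z ∷ []))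

module Submission where

-- Every finite subset of 𝕃 is the leaf structure of a binary tree, so 𝕃 satisfies the
-- axioms of a C-relation, each checked on trees; the rest is C-relation reasoning.
-- (⇐) Each condition for rer_a is an instance of Q on a quadruple containing a, e.g.
-- xy|u and xy|a give xy:ua; of the two disjuncts of f(x)f(y):f(u)f(a) the second,
-- f(x)|f(u)f(a), is excluded by f(a)|f(X∖{a}).
-- (⇒) By the symmetries of Q it suffices to treat xy|u and xy|v, distinguishing the
-- position of a: a ∈ {x, y}; xy|a, where (2) or (3) applies according as u lies in S^a_x
-- or not; or a closer to one of x, y, where the chain condition (4) yields
-- f(x)|f(u)f(v) and f(y)|f(u)f(v).

open import Defs
open import Level using (0ℓ)
open import Data.Nat using (ℕ; zero; suc)
open import Data.Nat.Properties using (eq?)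
open import Data.Fin using (Fin; zero; suc; #_)
open import Data.Fin.Properties using (any?)
import Data.Vec.Functional as V
open import Data.Empty using (⊥-elim)
open import Data.Unit using (tt)
open import Data.Product using (∃; _×_; _,_; proj₁; proj₂)
open import Data.Sum using (_⊎_; inj₁; inj₂; map)
open import Data.List using (_∷_; [])
open import Data.List.Relation.Unary.All using (All; _∷_; []; lookup)
open import Data.List.Relation.Unary.Any using (here; there)
open import Data.List.Relation.Unary.Any.Properties using (singleton⁻)
open import Data.List.Membership.Propositional using (_∈_)
open import Relation.Nullary using (¬_; Dec; yes; no)
import Relation.Nullary.Decidable as Dec
open import Relation.Unary using (Pred; _∩_; _⊆_)
open import Relation.Binary.PropositionalEquality using (_≡_; _≢_; refl; sym; trans; cong; ≢-sym)
open import Function using (_∘_; id)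
open import Function.Bundles using (_⇔_; Bijection; Equivalence; mk⇔; mk↣; _⤖_)
open import Function.Definitions using (Injective)
open import Function.Properties.Equivalence using () renaming (refl to ⇔-refl; trans to ⇔-trans)

private variable
  t : BTree

CT-irrefl : (p q : Leaf t) → ¬ CT p p q
CT-irrefl here      here      ()
CT-irrefl (left p)  (left q)  h = CT-irrefl p q h
CT-irrefl (left p)  (right q) ()
CT-irrefl (right p) (left q)  ()
CT-irrefl (right p) (right q) h = CT-irrefl p q h

CT-sym : (p q r : Leaf t) → CT p q r → CT p r q
CT-sym here      here      here      h  = h
CT-sym (left p)  (left q)  (left r)  h  = CT-sym p q r h
CT-sym (left p)  (left q)  (right r) ()
CT-sym (left p)  (right q) (left r)  ()
CT-sym (left p)  (right q) (right r) tt = tt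
CT-sym (right p) (left q)  (left r)  tt = tt
CT-sym (right p) (left q)  (right r) ()
CT-sym (right p) (right q) (left r)  ()
CT-sym (right p) (right q) (right r) h  = CT-sym p q r h

CT-asym : (p q r : Leaf t) → CT p q r → ¬ CT q p r
CT-asym here      here      here      ()
CT-asym (left p)  (left q)  (left r)  h h′ = CT-asym p q r h h′
CT-asym (left p)  (left q)  (right r) ()
CT-asym (left p)  (right q) (left r)  ()
CT-asym (left p)  (right q) (right r) _ ()
CT-asym (right p) (left q)  (left r)  _ ()
CT-asym (right p) (left q)  (right r) ()
CT-asym (right p) (right q) (left r)  ()
CT-asym (right p) (right q) (right r) h h′ = CT-asym p q r h h′

CT-split : (p q r : Leaf t) → CT p q r → ∀ s → CT p s r ⊎ CT s q r
CT-split here      here      here      () _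
CT-split (left p)  (left q)  (left r)  h (left s)  = CT-split p q r h s
CT-split (left p)  (left q)  (left r)  h (right s) = inj₂ tt
CT-split (left p)  (left q)  (right r) () _
CT-split (left p)  (right q) (left r)  () _
CT-split (left p)  (right q) (right r) h (left s)  = inj₂ tt
CT-split (left p)  (right q) (right r) h (right s) = inj₁ tt
CT-split (right p) (left q)  (left r)  h (left s)  = inj₁ tt
CT-split (right p) (left q)  (left r)  h (right s) = inj₂ tt
CT-split (right p) (left q)  (right r) () _
CT-split (right p) (right q) (left r)  () _
CT-split (right p) (right q) (right r) h (left s)  = inj₂ tt
CT-split (right p) (right q) (right r) h (right s) = CT-split p q r h s

CT-diag : (p q : Leaf t) → p ≢ q → CT p q q
CT-diag here      here      p≢q = p≢q refl
CT-diag (left p)  (left q)  p≢q = CT-diag p q (p≢q ∘ cong left)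
CT-diag (left p)  (right q) p≢q = tt
CT-diag (right p) (left q)  p≢q = tt
CT-diag (right p) (right q) p≢q = CT-diag p q (p≢q ∘ cong right)

CT-total : (p q r : Leaf t) → p ≢ q → q ≢ r → p ≢ r →
           CT p q r ⊎ CT q p r ⊎ CT r p q
CT-total here here here p≢q _ _ = ⊥-elim (p≢q refl)
CT-total (left p) (left q) (left r) p≢q q≢r p≢r =
  CT-total p q r (p≢q ∘ cong left) (q≢r ∘ cong left) (p≢r ∘ cong left)
CT-total (left p)  (left q)  (right r) _ _ _ = inj₂ (inj₂ tt)
CT-total (left p)  (right q) (left r)  _ _ _ = inj₂ (inj₁ tt)
CT-total (left p)  (right q) (right r) _ _ _ = inj₁ tt
CT-total (right p) (left q)  (left r)  _ _ _ = inj₁ tt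
CT-total (right p) (left q)  (right r) _ _ _ = inj₂ (inj₁ tt)
CT-total (right p) (right q) (left r)  _ _ _ = inj₂ (inj₂ tt)
CT-total (right p) (right q) (right r) p≢q q≢r p≢r =
  CT-total p q r (p≢q ∘ cong right) (q≢r ∘ cong right) (p≢r ∘ cong right)

CT? : (p q r : Leaf t) → Dec (CT p q r)
CT? here      here      here      = no λ ()
CT? (left p)  (left q)  (left r)  = CT? p q r
CT? (left p)  (left q)  (right r) = no λ ()
CT? (left p)  (right q) (left r)  = no λ ()
CT? (left p)  (right q) (right r) = yes tt
CT? (right p) (left q)  (left r)  = yes tt
CT? (right p) (left q)  (right r) = no λ ()
CT? (right p) (right q) (left r)  = no λ ()
CT? (right p) (right q) (right r) = CT? p q r

module CRelation (𝕃 : LStructure) where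
  open LStructure 𝕃 renaming (Carrier to L)
  open Equivalence using (to; from)

  _≟_ : (x y : L) → Dec (x ≡ y)
  _≟_ = eq? (mk↣ code-injective)
    where
    code : L → ℕ
    code x = proj₁ (enum-surj x)

    code-injective : Injective _≡_ _≡_ code
    code-injective {x} {y} eq =
      trans (sym (proj₂ (enum-surj x) refl)) (trans (cong enum eq) (proj₂ (enum-surj y) refl))

  record Deduplication {n : ℕ} (g : Fin (suc n) → L) : Set where
    field
      size               : ℕ
      distinct           : Fin (suc size) → L
      distinct-injective : Injective _≡_ _≡_ distinct
      index              : Fin (suc n) → Fin (suc size)
      distinct∘index     : ∀ i → distinct (index i) ≡ g i

  ∷-injective : ∀ {k} {x : L} {d : Fin (suc k) → L} → Injective _≡_ _≡_ d →
                ¬ (∃ λ j → d j ≡ x) → Injective _≡_ _≡_ (x V.∷ d)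
  ∷-injective d-inj x∉d {zero}  {zero}  _  = refl
  ∷-injective d-inj x∉d {zero}  {suc j} eq = ⊥-elim (x∉d (j , sym eq))
  ∷-injective d-inj x∉d {suc i} {zero}  eq = ⊥-elim (x∉d (i , eq))
  ∷-injective d-inj x∉d {suc i} {suc j} eq = cong suc (d-inj eq)

  deduplicate : ∀ {n} (g : Fin (suc n) → L) → Deduplication g
  deduplicate {zero} g = record
    { size = 0 ; distinct = g ; distinct-injective = λ { {zero} {zero} _ → refl }
    ; index = id ; distinct∘index = λ _ → refl }
  deduplicate {suc n} g with deduplicate (g ∘ suc)
  ... | D with any? (λ j → Deduplication.distinct D j ≟ g zero)
  ... | yes (j , dj≡g₀) = record
    { size = size ; distinct = distinct ; distinct-injective = distinct-injective
    ; index = λ { zero → j ; (suc i) → index i }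
    ; distinct∘index = λ { zero → dj≡g₀ ; (suc i) → distinct∘index i } }
    where open Deduplication D
  ... | no g₀∉D = record
    { size = suc size ; distinct = g zero V.∷ distinct
    ; distinct-injective = ∷-injective distinct-injective g₀∉D
    ; index = λ { zero → zero ; (suc i) → suc (index i) }
    ; distinct∘index = λ { zero → refl ; (suc i) → distinct∘index i } }
    where open Deduplication D

  C-resp-≡ : ∀ {x x′ y y′ z z′} → x ≡ x′ → y ≡ y′ → z ≡ z′ → C x y z ⇔ C x′ y′ z′
  C-resp-≡ refl refl refl = ⇔-refl

  record LeafRepresentation {n : ℕ} (g : Fin (suc n) → L) : Set where
    field
      tree              : BTree
      position          : Fin (suc n) → Leaf tree
      position-reflects : ∀ i j → position i ≡ position j → g i ≡ g j
      C⇔CT              : ∀ i j k → C (g i) (g j) (g k) ⇔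
                                    CT (position i) (position j) (position k)

  represent : ∀ {n} (g : Fin (suc n) → L) → LeafRepresentation g
  represent g = record
    { tree = tree
    ; position = Bijection.to h ∘ index
    ; position-reflects = λ i j eq →
        trans (sym (distinct∘index i))
              (trans (cong distinct (Bijection.injective h eq)) (distinct∘index j))
    ; C⇔CT = λ i j k →
        ⇔-trans (C-resp-≡ (sym (distinct∘index i)) (sym (distinct∘index j))
                          (sym (distinct∘index k)))
                (iso (index i) (index j) (index k)) }
    where
    open Deduplication (deduplicate g)

    tree : BTree
    tree = proj₁ (age-⊆ size distinct distinct-injective)

    h : Fin (suc size) ⤖ Leaf tree
    h = proj₁ (proj₂ (age-⊆ size distinct distinct-injective))

    iso : ∀ i j k → C (distinct i) (distinct j) (distinct k) ⇔
                    CT (Bijection.to h i) (Bijection.to h j) (Bijection.to h k)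
    iso = proj₂ (proj₂ (age-⊆ size distinct distinct-injective))

  private
    module Rep {n} (g : Fin (suc n) → L) = LeafRepresentation {g = g} (represent g)

  -- Opaque: unfolding these proofs exposes deduplication through the enumeration of 𝕃,
  -- which makes the with-abstractions over them below intractable.
  abstract
    C-sym : ∀ {x y z} → C x y z → C x z y
    C-sym {x} {y} {z} c =
      from (C⇔CT (# 0) (# 2) (# 1)) (CT-sym (position (# 0)) (position (# 1)) (position (# 2))
                                            (to (C⇔CT (# 0) (# 1) (# 2)) c))
      where open Rep (x V.∷ y V.∷ z V.∷ V.[])

    C-asym : ∀ {x y z} → C x y z → ¬ C y x z
    C-asym {x} {y} {z} c c′ =
      CT-asym (position (# 0)) (position (# 1)) (position (# 2))
              (to (C⇔CT (# 0) (# 1) (# 2)) c) (to (C⇔CT (# 1) (# 0) (# 2)) c′)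
      where open Rep (x V.∷ y V.∷ z V.∷ V.[])

    C-total : ∀ {x y z} → x ≢ y → y ≢ z → x ≢ z → C x y z ⊎ C y x z ⊎ C z x y
    C-total {x} {y} {z} x≢y y≢z x≢z =
      map (from (C⇔CT (# 0) (# 1) (# 2)))
          (map (from (C⇔CT (# 1) (# 0) (# 2))) (from (C⇔CT (# 2) (# 0) (# 1))))
          (CT-total (position (# 0)) (position (# 1)) (position (# 2))
                    (x≢y ∘ position-reflects (# 0) (# 1))
                    (y≢z ∘ position-reflects (# 1) (# 2))
                    (x≢z ∘ position-reflects (# 0) (# 2)))
      where open Rep (x V.∷ y V.∷ z V.∷ V.[])

    C? : ∀ x y z → Dec (C x y z)
    C? x y z =
      Dec.map′ (from (C⇔CT (# 0) (# 1) (# 2))) (to (C⇔CT (# 0) (# 1) (# 2)))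
               (CT? (position (# 0)) (position (# 1)) (position (# 2)))
      where open Rep (x V.∷ y V.∷ z V.∷ V.[])

    C-irrefl : ∀ {x y z} → C x y z → x ≢ y
    C-irrefl {x} {z = z} c refl =
      CT-irrefl (position (# 0)) (position (# 1)) (to (C⇔CT (# 0) (# 0) (# 1)) c)
      where open Rep (x V.∷ z V.∷ V.[])

    C-diag : ∀ {x y} → x ≢ y → C x y y
    C-diag {x} {y} x≢y =
      from (C⇔CT (# 0) (# 1) (# 1))
           (CT-diag (position (# 0)) (position (# 1)) (x≢y ∘ position-reflects (# 0) (# 1)))
      where open Rep (x V.∷ y V.∷ V.[])

    C-split : ∀ {x y z} → C x y z → ∀ w → C x w z ⊎ C w y z
    C-split {x} {y} {z} c w =
      map (from (C⇔CT (# 0) (# 3) (# 2))) (from (C⇔CT (# 3) (# 1) (# 2)))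
          (CT-split (position (# 0)) (position (# 1)) (position (# 2))
                    (to (C⇔CT (# 0) (# 1) (# 2)) c) (position (# 3)))
      where open Rep (x V.∷ y V.∷ z V.∷ w V.∷ V.[])

  C-pivot : ∀ {x w y z} → C x w y → C x w z → C x y z
  C-pivot {y = y} {z} cwy cwz with C-split cwy z
  ... | inj₁ czy = C-sym czy
  ... | inj₂ czwy with C-split cwz y
  ...   | inj₁ cyz = cyz
  ...   | inj₂ cywz = ⊥-elim (C-asym (C-sym cywz) (C-sym czwy))

  C-total′ : ∀ {a x y} → a ≢ x → a ≢ y → ¬ C a x y → C x a y ⊎ C y a x
  C-total′ {a} a≢x a≢y ¬caxy with C-total a≢x (λ { refl → ¬caxy (C-diag a≢x) }) a≢y
  ... | inj₁ caxy = ⊥-elim (¬caxy caxy)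
  ... | inj₂ c = c

  C-across : ∀ {a b d u u′ v} → ¬ C a b d → C a b u → C a b u′ → C a d v → C v u u′
  C-across ¬cabd cbu cbu′ cdv with C-split (C-pivot cbu cbu′) _
  ... | inj₁ cavu′ =
    ⊥-elim (¬cabd (C-pivot (C-sym (C-pivot (C-sym cbu′) (C-sym cavu′))) (C-sym cdv)))
  ... | inj₂ cvuu′ = cvuu′

module QCharacterisation (𝕃 : LStructure) where
  open LStructure 𝕃 renaming (Carrier to L)
  open Notions 𝕃
  open CRelation 𝕃

  private variable
    p q x y z u v : L
    Y Y′ Z Z′ : Pred L 0ℓ

  Sep-sym : Sep Y Z → Sep Z Y
  Sep-sym (s , s′) = s′ , s

  Sep-anti : Y′ ⊆ Y → Z′ ⊆ Z → Sep Y Z → Sep Y′ Z′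
  Sep-anti Y′⊆Y Z′⊆Z (s , s′) =
    (λ y y′ z Yy Yy′ Zz → s y y′ z (Y′⊆Y Yy) (Y′⊆Y Yy′) (Z′⊆Z Zz)) ,
    (λ z z′ y Zz Zz′ Yy → s′ z z′ y (Z′⊆Z Zz) (Z′⊆Z Zz′) (Y′⊆Y Yy))

  Sep⇒C : Sep Y Z → Y y → Y z → Z x → C x y z
  Sep⇒C (s , _) = s _ _ _

  point-sep : (∀ {y z} → Z y → Z z → C p y z) → Sep ⟦ p ⟧ Z
  point-sep h = (λ { _ _ _ refl refl Zz → C-diag (≢-sym (C-irrefl (h Zz Zz))) }) ,
                (λ { _ _ _ Zy Zz refl → h Zy Zz })

  point-sepL : ∀ {qs} → All (C p q) qs → SepL (p ∷ []) qs
  point-sepL pivot = Sep-anti singleton⁻ id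
                     (point-sep λ y∈ z∈ → C-pivot (lookup pivot y∈) (lookup pivot z∈))

  Img-mono : {f : L → L} → Y ⊆ Z → Img f Y ⊆ Img f Z
  Img-mono Y⊆Z (x , Yx , refl) = x , Y⊆Z Yx , refl

  Q-swapˡ : Q x y u v → Q y x u v
  Q-swapˡ (inj₁ (cuxy , cvxy)) = inj₁ (C-sym cuxy , C-sym cvxy)
  Q-swapˡ (inj₂ (cxuv , cyuv)) = inj₂ (cyuv , cxuv)

  Q-swap : Q x y u v → Q u v x y
  Q-swap (inj₁ c) = inj₂ c
  Q-swap (inj₂ c) = inj₁ c

  S-sub : ∀ {a b d} → C a b d → S a b ⊆ S a d
  S-sub cbd (y≢a , cby) = y≢a , C-pivot cbd cby

  module _ {X : Pred L 0ℓ} {a : L} {f : L → L} (fa∣fA : Sep ⟦ f a ⟧ (Img f (X ∖｛ a ｝))) where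

    private
      A : Pred L 0ℓ
      A = X ∖｛ a ｝

    fufv∣fa : A u → A v → C (f a) (f u) (f v)
    fufv∣fa Au Av = Sep⇒C (Sep-sym fa∣fA) (_ , Au , refl) (_ , Av , refl) refl

    fafa∣fu : A u → C (f u) (f a) (f a)
    fafa∣fu Au = Sep⇒C fa∣fA refl refl (_ , Au , refl)

    ¬fvfa∣fu : A u → A v → ¬ C (f u) (f v) (f a)
    ¬fvfa∣fu Au Av c = C-asym (C-sym c) (fufv∣fa Au Av)

    S-self : A x → S a x x
    S-self (_ , x≢a) = x≢a , C-diag (≢-sym x≢a)

    preservesQ⇒behavesRer : X a → preservesQ f X → behavesRer f a A
    preservesQ⇒behavesRer Xa pQ = fa∣fS , preserves-S , S-equal-or-apart , chain-condition
      where
      C-image-of-Q : A x → A y → A u → Q x y u a → C (f u) (f x) (f y)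
      C-image-of-Q Ax Ay Au q with pQ _ _ _ _ (proj₁ Ax) (proj₁ Ay) (proj₁ Au) Xa q
      ... | inj₁ (cfu , _) = cfu
      ... | inj₂ (cfx , _) = ⊥-elim (¬fvfa∣fu Ax Au cfx)

      fa∣fS : ∀ b → A b → Sep ⟦ f a ⟧ (Img f (A ∩ S a b))
      fa∣fS _ _ = Sep-anti id (Img-mono proj₁) fa∣fA

      preserves-S : ∀ b → A b → preservesC f (A ∩ S a b)
      preserves-S _ _ _ _ _ (Ax , _) (Ay , _ , cby) (Az , _ , cbz) cxyz =
        C-image-of-Q Ay Az Ax (inj₁ (cxyz , C-pivot cby cbz))

      images-apart : ∀ {b d} → ¬ C a b d → ∀ y y′ z →
                     Img f (A ∩ S a b) y → Img f (A ∩ S a b) y′ → Img f (A ∩ S a d) z → C z y y′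
      images-apart ¬cbd _ _ _ (_ , (Au , _ , cbu) , refl) (_ , (Au′ , _ , cbu′) , refl)
                               (_ , (Av , _ , cdv) , refl) =
        C-image-of-Q Au Au′ Av (inj₁ (C-across ¬cbd cbu cbu′ cdv , C-pivot cbu cbu′))

      S-equal-or-apart : ∀ b d → A b → A d →
                         (∀ y → (S a b y → S a d y) × (S a d y → S a b y)) ⊎
                         Sep (Img f (A ∩ S a b)) (Img f (A ∩ S a d))
      S-equal-or-apart b d _ _ with C? a b d
      ... | yes cbd = inj₁ λ _ → S-sub cbd , S-sub (C-sym cbd)
      ... | no ¬cbd = inj₂ (images-apart ¬cbd , images-apart (¬cbd ∘ C-sym))

      chain-condition : ∀ x y z → A x → A y → A z →
                        SepL (x ∷ []) (y ∷ z ∷ a ∷ []) → SepL (y ∷ []) (z ∷ a ∷ []) →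
                        SepL (f x ∷ f y ∷ f z ∷ []) (f a ∷ []) × SepL (f x ∷ f y ∷ []) (f z ∷ [])
      chain-condition x y z Ax Ay Az x∣yza y∣za =
        Sep-sym (Sep-anti singleton⁻ images⊆fA fa∣fA) ,
        Sep-sym (point-sepL (C-diag (C-irrefl cfz) ∷ cfz ∷ []))
        where
        cfz : C (f z) (f x) (f y)
        cfz = C-image-of-Q Ax Ay Az
                (inj₂ (Sep⇒C (Sep-sym x∣yza) (there (here refl)) (there (there (here refl)))
                             (here refl) ,
                       Sep⇒C (Sep-sym y∣za) (here refl) (there (here refl)) (here refl)))

        images⊆fA : (_∈ f x ∷ f y ∷ f z ∷ []) ⊆ Img f A
        images⊆fA (here refl)                 = x , Ax , refl
        images⊆fA (there (here refl))         = y , Ay , refl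
        images⊆fA (there (there (here refl))) = z , Az , refl

    module _ (rer : behavesRer f a A) where
      private
        preserves-S : ∀ b → A b → preservesC f (A ∩ S a b)
        preserves-S = proj₁ (proj₂ rer)

        S-equal-or-apart : ∀ b d → A b → A d →
                           (∀ y → (S a b y → S a d y) × (S a d y → S a b y)) ⊎
                           Sep (Img f (A ∩ S a b)) (Img f (A ∩ S a d))
        S-equal-or-apart = proj₁ (proj₂ (proj₂ rer))

        chain-condition : ∀ x y z → A x → A y → A z →
                          SepL (x ∷ []) (y ∷ z ∷ a ∷ []) → SepL (y ∷ []) (z ∷ a ∷ []) →
                          SepL (f x ∷ f y ∷ f z ∷ []) (f a ∷ []) × SepL (f x ∷ f y ∷ []) (f z ∷ [])
        chain-condition = proj₂ (proj₂ (proj₂ rer))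

      images-S-apart : A x → A u → ¬ C a x u → Sep (Img f (A ∩ S a x)) (Img f (A ∩ S a u))
      images-S-apart Ax Au ¬cxu with S-equal-or-apart _ _ Ax Au
      ... | inj₁ Sx≐Su = ⊥-elim (¬cxu (proj₂ (proj₂ (Sx≐Su _) (S-self Au))))
      ... | inj₂ apart = apart

      C-image-a-outside : A x → A y → X u → C a x y → C u x y → C (f u) (f x) (f y)
      C-image-a-outside {x} {u = u} Ax Ay Xu caxy cuxy with u ≟ a
      ... | yes refl = fufv∣fa Ax Ay
      ... | no u≢a with C? a x u
      ...   | yes caxu = preserves-S _ Ax _ _ _ ((Xu , u≢a) , u≢a , caxu) (Ax , S-self Ax)
                                               (Ay , proj₂ Ay , caxy) cuxy
      ...   | no ¬caxu = Sep⇒C (images-S-apart Ax (Xu , u≢a) ¬caxu)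
                           (_ , (Ax , S-self Ax) , refl) (_ , (Ay , proj₂ Ay , caxy) , refl)
                           (_ , ((Xu , u≢a) , S-self (Xu , u≢a)) , refl)

      C-image-chain : A x → A y → A z → C x a y → C x a z → C y a z → C (f z) (f x) (f y)
      C-image-chain Ax Ay Az cxay cxaz cyaz =
        Sep⇒C (proj₂ (chain-condition _ _ _ Ax Ay Az
                        (point-sepL (cxay ∷ cxaz ∷ C-diag (C-irrefl cxay) ∷ []))
                        (point-sepL (cyaz ∷ C-diag (C-irrefl cyaz) ∷ []))))
              (here refl) (there (here refl)) (here refl)

      C-image-a-near : A y → A u → A v → C u a y → C v a y → C (f y) (f u) (f v)
      C-image-a-near {u = u} {v} Ay Au Av cuay cvay with C? a u v
      ... | yes cauv = Sep⇒C (images-S-apart Au Ay (C-asym cuay))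
                         (_ , (Au , S-self Au) , refl) (_ , (Av , proj₂ Av , cauv) , refl)
                         (_ , (Ay , S-self Ay) , refl)
      ... | no ¬cauv with C-total′ (≢-sym (proj₂ Au)) (≢-sym (proj₂ Av)) ¬cauv
      ...   | inj₁ cuav = C-image-chain Au Av Ay cuav cuay cvay
      ...   | inj₂ cvau = C-sym (C-image-chain Av Au Ay cvau cvay cuay)

      Q-image-a-beside-x : A x → A y → X u → X v → C u x y → C v x y → C y a x →
                           Q (f x) (f y) (f u) (f v)
      Q-image-a-beside-x {x} {y} {u} {v} Ax Ay Xu Xv cuxy cvxy cyax =
        inj₂ (C-pivot (C-sym (C-fx Au cuxy)) (C-sym (C-fx Av cvxy)) ,
              C-image-a-near Ay Au Av (C-uay cuxy) (C-uay cvxy))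
        where
        ≢a : ∀ {u} → C u x y → u ≢ a
        ≢a cuxy refl = C-asym cyax (C-sym cuxy)

        Au : A u
        Au = Xu , ≢a cuxy

        Av : A v
        Av = Xv , ≢a cvxy

        C-uay : ∀ {u} → C u x y → C u a y
        C-uay cuxy with C-split cuxy a
        ... | inj₁ cuay = cuay
        ... | inj₂ caxy = ⊥-elim (≢a caxy refl)

        C-fx : ∀ {u} → A u → C u x y → C (f x) (f u) (f y)
        C-fx Au cuxy = C-image-chain Au Ay Ax (C-uay cuxy)
                         (C-pivot (C-sym (C-uay cuxy)) (C-sym cuxy)) cyax

      Q-image-at-a : X y → A u → A v → C u a y → C v a y → Q (f a) (f y) (f u) (f v)
      Q-image-at-a {y} Xy Au Av cuay cvay with y ≟ a
      ... | yes refl = inj₁ (fafa∣fu Au , fafa∣fu Av)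
      ... | no y≢a = inj₂ (fufv∣fa Au Av , C-image-a-near (Xy , y≢a) Au Av cuay cvay)

      Q-image-off-a : A x → A y → X u → X v → C u x y → C v x y → Q (f x) (f y) (f u) (f v)
      Q-image-off-a {x} {y} Ax Ay Xu Xv cuxy cvxy with C? a x y
      ... | yes caxy = inj₁ (C-image-a-outside Ax Ay Xu caxy cuxy ,
                             C-image-a-outside Ax Ay Xv caxy cvxy)
      ... | no ¬caxy with C-total′ (≢-sym (proj₂ Ax)) (≢-sym (proj₂ Ay)) ¬caxy
      ...   | inj₁ cxay = Q-swapˡ (Q-image-a-beside-x Ay Ax Xu Xv (C-sym cuxy) (C-sym cvxy) cxay)
      ...   | inj₂ cyax = Q-image-a-beside-x Ax Ay Xu Xv cuxy cvxy cyax

      Q-image : X x → X y → X u → X v → C u x y → C v x y → Q (f x) (f y) (f u) (f v)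
      Q-image {x} {y} Xx Xy Xu Xv cuxy cvxy with x ≟ a | y ≟ a
      ... | yes refl | _ =
        Q-image-at-a Xy (Xu , C-irrefl cuxy) (Xv , C-irrefl cvxy) cuxy cvxy
      ... | no _ | yes refl =
        Q-swapˡ (Q-image-at-a Xx (Xu , C-irrefl (C-sym cuxy)) (Xv , C-irrefl (C-sym cvxy))
                              (C-sym cuxy) (C-sym cvxy))
      ... | no x≢a | no y≢a = Q-image-off-a (Xx , x≢a) (Xy , y≢a) Xu Xv cuxy cvxy

      behavesRer⇒preservesQ : preservesQ f X
      behavesRer⇒preservesQ _ _ _ _ Xx Xy Xu Xv (inj₁ (cuxy , cvxy)) =
        Q-image Xx Xy Xu Xv cuxy cvxy
      behavesRer⇒preservesQ _ _ _ _ Xx Xy Xu Xv (inj₂ (cxuv , cyuv)) =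
        Q-swap (Q-image Xu Xv Xx Xy cxuv cyuv)

corollaryQ : (𝕃 : LStructure) → let open Notions 𝕃 in
    (X : Pred (LStructure.Carrier 𝕃) 0ℓ) (a : LStructure.Carrier 𝕃) → X a →
    (f : LStructure.Carrier 𝕃 → LStructure.Carrier 𝕃) →
    Sep ⟦ f a ⟧ (Img f (X ∖｛ a ｝)) →
    behavesRer f a (X ∖｛ a ｝) ⇔ preservesQ f X
corollaryQ 𝕃 X a Xa f fa∣fA =
  mk⇔ (behavesRer⇒preservesQ fa∣fA) (preservesQ⇒behavesRer fa∣fA Xa)
  where open QCharacterisation 𝕃
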